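{- Let $n\ge 1$ be an integer, put $C=(n+2)^2+1$, and let $N=\{1,\dots,2n+2\}\cup\{n^2+2n+3,\dots,(n+2)^2\}$. For $x\in N$ write $\bar x=C-x$, and for $x,y\in N$ write $d_{xy}=x+y-C$. Let $v,w,b_1,\dots,b_n,c_1,\dots,c_n$ be $2n+2$ elements of $N$ such that no two of them are equal and no two of them are complementary, so that $\{v,w,b_1,\dots,b_n,c_1,\dots,c_n\}$ together with the complements $\{\bar v,\bar w,\bar b_1,\dots,\bar b_n,\bar c_1,\dots,\bar c_n\}$ is exactly $N$. Assume: (i) if $n$ is even: the $n+2$ numbers $v,w,b_1,\dots,b_n$ can be partitioned into $(n+2)/2$ pairs $\beta$ with $\sum_{(x,y)\in\beta}d_{xy}=0$, and the $n$ numbers $c_1,\dots,c_n$ can be partitioned into $n/2$ pairs $\gamma$ with $\sum_{(x,y)\in\gamma}d_{xy}=-d_{v\bar w}$; (ii) if $n$ is odd: setting $d_v=v-\frac{C}{2}$, the $n+1$ numbers $b_1,\dots,b_n,w$ can be partitioned into $(n+1)/2$ pairs $\beta$ with $\sum_{(x,y)\in\beta}d_{xy}+d_v=0$, and the $n+1$ numbers $c_1,\dots,c_n,\bar w$ can be partitioned into $(n+1)/2$ pairs $\gamma$ with $\sum_{(x,y)\in\gamma}d_{xy}+d_v=0$. Place these numbers in the border cells of an $(n+2)\times(n+2)$ array as follows: top row $v,b_1,\dots,b_n,w$ (left to right); bottom row $\bar w,\bar b_1,\dots,\bar b_n,\bar v$ (left to right); left column between the corners $c_1,\dots,c_n$ (top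 to bottom); right column between the corners $\bar c_1,\dots,\bar c_n$ (top to bottom). Then the resulting border is a magic border, i.e. each of its first row, last row, first column and last column has sum $S_{n+2}=\frac{n+2}{2}\big((n+2)^2+1\big)$.
   Context: The border of an $(n+2)\times(n+2)$ array is the set of cells in its first and last row and first and last column. Two numbers $a,b$ are complementary if $a+b=(n+2)^2+1$. A magic border (surrounding an inner square of order $n$) is a filling of the border cells with numbers such that every pair of opposite cells (the two diagonally opposite corners, and the two cells in the same column of the top and bottom rows, and the two cells in the same row of the left and right columns) contains complementary numbers and each of the four border lines sums to $S_{n+2}=\frac{n+2}{2}((n+2)^2+1)$, the magic constant of order $n+2$. -}

module Defs where

open import Data.Nat using (ℕ; zero; suc; _+_; _*_; _∸_; _^_; _≤_; _/_)
open import Data.Nat.Properties using (_≟_)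
open import Data.Integer as ℤ using (ℤ; +_; -_)
open import Data.Fin using (Fin; zero; suc; toℕ; fromℕ; inject₁)
open import Data.List using (List; []; _∷_; _++_; map; foldr; concatMap)
import Data.List as L
import Data.Vec as V
open import Data.Product using (_×_; _,_; ∃)
open import Data.Sum using (_⊎_)
open import Data.Bool using (if_then_else_)
open import Relation.Nullary.Decidable using (⌊_⌋)
open import Relation.Binary.PropositionalEquality using (_≡_)
open import Data.List.Relation.Binary.Permutation.Propositional using (_↭_)

Cn : ℕ → ℕ
Cn n = (n + 2) ^ 2 + 1

-- magic constant S_{n+2} = (n+2)/2 * ((n+2)^2+1)  (always an integer)
Sn : ℕ → ℕ
Sn n = ((n + 2) * Cn n) / 2

InN : ℕ → ℕ → Set
InN n x = (1 ≤ x × x ≤ 2 * n + 2) ⊎ (n ^ 2 + 2 * n + 3 ≤ x × x ≤ (n + 2) ^ 2)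

-- complement  x̄ = C - x  (exact for x ∈ N)
bar : ℕ → ℕ → ℕ
bar n x = Cn n ∸ x

dxy : ℕ → ℕ → ℕ → ℤ
dxy n x y = (+ (x + y)) ℤ.- (+ Cn n)

sumℤ : List ℤ → ℤ
sumℤ = foldr ℤ._+_ (+ 0)

flatten : List (ℕ × ℕ) → List ℕ
flatten = concatMap (λ { (x , y) → x ∷ y ∷ [] })

-- xs can be partitioned into pairs (a list ps of pairs using every entry of xs
-- exactly once) such that  Σ_{(x,y) ∈ ps} d_{xy} + extra ≡ target
PairPartition : ℕ → List ℕ → ℤ → ℤ → Set
PairPartition n xs extra target =
  ∃ λ (ps : List (ℕ × ℕ)) →
    (flatten ps ↭ xs) × (sumℤ (map (λ { (x , y) → dxy n x y }) ps) ℤ.+ extra ≡ target)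

-- a line of length n+2:  a, f 0, …, f (n-1), z
frame : ∀ {n} → ℕ → (Fin n → ℕ) → ℕ → Fin (suc (suc n)) → ℕ
frame a f z zero = a
frame {zero} a f z (suc zero) = z
frame {suc n} a f z (suc j) = frame (f zero) (λ k → f (suc k)) z j

-- the (n+2)×(n+2) array with the prescribed border (interior cells filled with 0;
-- they play no role)
borderArray : (n : ℕ) (v w : ℕ) (b c : Fin n → ℕ) →
              Fin (suc (suc n)) → Fin (suc (suc n)) → ℕ
borderArray n v w b c i j =
  if ⌊ toℕ i ≟ 0 ⌋ then frame v b w j
  else if ⌊ toℕ i ≟ suc n ⌋ then frame (bar n w) (λ k → bar n (b k)) (bar n v) j
  else if ⌊ toℕ j ≟ 0 ⌋ then frame v c (bar n w) i
  else if ⌊ toℕ j ≟ suc n ⌋ then frame w (λ k → bar n (c k)) (bar n v) i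
  else 0

sumFin : ∀ {m} → (Fin m → ℕ) → ℕ
sumFin f = V.sum (V.tabulate f)

MagicBorder : (n : ℕ) → (Fin (suc (suc n)) → Fin (suc (suc n)) → ℕ) → Set
MagicBorder n A =
  (A first first + A last last ≡ Cn n) ×
  (A first last + A last first ≡ Cn n) ×
  (∀ (j : Fin n) → A first (inner j) + A last (inner j) ≡ Cn n) ×
  (∀ (i : Fin n) → A (inner i) first + A (inner i) last ≡ Cn n) ×
  (sumFin (λ j → A first j) ≡ Sn n) ×
  (sumFin (λ j → A last j) ≡ Sn n) ×
  (sumFin (λ i → A i first) ≡ Sn n) ×
  (sumFin (λ i → A i last) ≡ Sn n)
  where
    first : Fin (suc (suc n))
    first = zero
    last : Fin (suc (suc n))
    last = fromℕ (suc n)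
    inner : Fin n → Fin (suc (suc n))
    inner k = suc (inject₁ k)

{-# OPTIONS --safe #-}
module Submission where

-- Each pair {x, y} contributes x + y = C + d_xy, so the pairing conditions say that
-- the top row v + Σ b + w and the left column v + Σ c + w̄ are made of (n + 2)/2 pairs
-- of total C each (for odd n, d_v supplies the missing half pair v - C/2, and C is
-- even).  Hence both sum to S = (n + 2) C / 2.  The bottom row and the right column
-- hold the complements of the top row and the left column, so each sums to
-- (n + 2) C - S = S.

open import Defs
open import Data.Nat using (ℕ; _+_; _≤_; _%_; _/_)
open import Data.Integer as ℤ using (ℤ; +_; -_)
open import Data.Fin using (Fin)
open import Data.List using (List; []; _∷_; _++_; tabulate)
open import Data.List.Relation.Unary.All using (All)
open import Data.List.Relation.Unary.AllPairs using (AllPairs)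
open import Data.Product using (_×_)
open import Relation.Binary.PropositionalEquality using (_≡_; _≢_)

open import Data.Bool using (if_then_else_)
open import Data.Fin using (zero; suc; toℕ; fromℕ; inject₁)
open import Data.Fin.Properties using (toℕ-injective; toℕ-fromℕ)
import Data.Integer.Properties as ℤₚ
import Data.Integer.Tactic.RingSolver as ℤ-Solver
open import Data.List using (length; map)
open import Data.List.Properties using (length-tabulate; length-++)
open import Data.List.Relation.Binary.Permutation.Propositional.Properties using (↭-length)
open import Data.List.Relation.Unary.All using (_∷_)
open import Data.List.Relation.Unary.All.Properties using (++⁻; tabulate⁻)
open import Data.Nat using (zero; suc; _*_; _∸_; _^_; s≤s; _≟_)
open import Data.Nat.DivMod using (m*n/n≡m; m%n<n)
open import Data.Nat.ListAction using (sum)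
open import Data.Nat.ListAction.Properties using (sum-↭; sum-++)
open import Data.Nat.Properties
  using (+-comm; +-assoc; +-identityʳ; *-identityˡ; *-comm; *-distribʳ-+; +-cancelʳ-≡;
         ≤-trans; ≤-reflexive; m≤m+n; m+[n∸m]≡n; m∸n+n≡m;
         +-commutativeSemigroup; *-commutativeSemigroup)
open import Algebra.Properties.CommutativeSemigroup +-commutativeSemigroup using (interchange)
open import Algebra.Properties.CommutativeSemigroup *-commutativeSemigroup using (xy∙z≈xz∙y)
open import Data.Nat.Tactic.RingSolver using (solve-∀)
open import Data.Product using (_,_; proj₁; proj₂; ∃; uncurry)
import Data.Product as Product
open import Data.Sum using (_⊎_; inj₁; inj₂)
import Data.Vec as V
open import Data.Vec.Properties using (tabulate-cong)
open import Function using (_∘_)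
open import Relation.Binary.PropositionalEquality
  using (_≗_; refl; sym; trans; cong; cong₂; module ≡-Reasoning)
open import Relation.Nullary using (Dec; yes; no; ¬_; contradiction)
open import Relation.Nullary.Decidable using (⌊_⌋)

open ≡-Reasoning

frame-inner : ∀ {n} a (f : Fin n → ℕ) z (k : Fin n) → frame a f z (suc (inject₁ k)) ≡ f k
frame-inner {suc n} a f z zero    = refl
frame-inner {suc n} a f z (suc k) = frame-inner (f zero) (f ∘ suc) z k

frame-last : ∀ {n} a (f : Fin n → ℕ) z → frame a f z (fromℕ (suc n)) ≡ z
frame-last {zero}  a f z = refl
frame-last {suc n} a f z = frame-last (f zero) (f ∘ suc) z

frame-toℕ≡last : ∀ {n} a (f : Fin n → ℕ) z (i : Fin (suc (suc n))) →
                 toℕ i ≡ suc n → frame a f z i ≡ z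
frame-toℕ≡last {n} a f z i i≡last =
  trans (cong (frame a f z) (toℕ-injective (trans i≡last (sym (toℕ-fromℕ (suc n))))))
        (frame-last a f z)

sumFin-cong : ∀ {n} {f g : Fin n → ℕ} → f ≗ g → sumFin f ≡ sumFin g
sumFin-cong f≗g = cong V.sum (tabulate-cong f≗g)

sum-tabulate : ∀ {n} (f : Fin n → ℕ) → sum (tabulate f) ≡ sumFin f
sum-tabulate {zero}  f = refl
sum-tabulate {suc n} f = cong (_+_ (f zero)) (sum-tabulate (f ∘ suc))

sumFin-frame : ∀ {n} a (f : Fin n → ℕ) z → sumFin (frame a f z) ≡ a + (sumFin f + z)
sumFin-frame {zero}  a f z = cong (_+_ a) (+-identityʳ z)
sumFin-frame {suc n} a f z =
  cong (_+_ a) (trans (sumFin-frame (f zero) (f ∘ suc) z) (sym (+-assoc (f zero) _ z)))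

sumFin-complement : ∀ {n} C (f : Fin n → ℕ) → (∀ k → f k ≤ C) →
                    sumFin (λ k → C ∸ f k) + sumFin f ≡ n * C
sumFin-complement {zero}  C f f≤C = refl
sumFin-complement {suc n} C f f≤C =
  trans (interchange (C ∸ f zero) _ (f zero) _)
        (cong₂ _+_ (m∸n+n≡m (f≤C zero)) (sumFin-complement C (f ∘ suc) (f≤C ∘ suc)))

sumFin-frame-complement : ∀ {n} C a₁ a₂ z₁ z₂ (f : Fin n → ℕ) → (∀ k → f k ≤ C) →
                          a₁ + a₂ ≡ C → z₁ + z₂ ≡ C →
                          sumFin (frame z₂ (λ k → C ∸ f k) a₂) + sumFin (frame a₁ f z₁) ≡ (n + 2) * C
sumFin-frame-complement {n} C a₁ a₂ z₁ z₂ f f≤C a₁+a₂≡C z₁+z₂≡C = begin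
  sumFin (frame z₂ f̄ a₂) + sumFin (frame a₁ f z₁)
    ≡⟨ cong₂ _+_ (sumFin-frame z₂ f̄ a₂) (sumFin-frame a₁ f z₁) ⟩
  (z₂ + (sumFin f̄ + a₂)) + (a₁ + (sumFin f + z₁))
    ≡⟨ regroup z₂ (sumFin f̄) a₂ a₁ (sumFin f) z₁ ⟩
  (a₁ + a₂) + ((sumFin f̄ + sumFin f) + (z₁ + z₂))
    ≡⟨ cong₂ (λ a s → a + (s + (z₁ + z₂))) a₁+a₂≡C (sumFin-complement C f f≤C) ⟩
  C + (n * C + (z₁ + z₂))
    ≡⟨ cong (λ z → C + (n * C + z)) z₁+z₂≡C ⟩
  C + (n * C + C)
    ≡⟨ collect C n ⟩
  (n + 2) * C
    ∎
  where
    f̄ : Fin n → ℕ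
    f̄ k = C ∸ f k
    regroup : ∀ z₂ s̄ a₂ a₁ s z₁ → (z₂ + (s̄ + a₂)) + (a₁ + (s + z₁)) ≡ (a₁ + a₂) + ((s̄ + s) + (z₁ + z₂))
    regroup = solve-∀
    collect : ∀ C n → C + (n * C + C) ≡ (n + 2) * C
    collect = solve-∀

if-dec : ∀ {P A : Set} (d : Dec P) {x y z : A} → (P → x ≡ z) → (¬ P → y ≡ z) →
         (if ⌊ d ⌋ then x else y) ≡ z
if-dec (yes p) onYes onNo = onYes p
if-dec (no ¬p) onYes onNo = onNo ¬p

module BorderLines (n v w : ℕ) (b c : Fin n → ℕ) where

  private
    if-last : ∀ {A : Set} {x y : A} → (if ⌊ toℕ (fromℕ (suc n)) ≟ suc n ⌋ then x else y) ≡ x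
    if-last = if-dec (toℕ (fromℕ (suc n)) ≟ suc n) (λ _ → refl) (contradiction (toℕ-fromℕ (suc n)))

  borderArray-bottom : ∀ j → borderArray n v w b c (fromℕ (suc n)) j ≡ frame (bar n w) (bar n ∘ b) (bar n v) j
  borderArray-bottom j = if-last

  borderArray-left : ∀ i → borderArray n v w b c i zero ≡ frame v c (bar n w) i
  borderArray-left zero    = refl
  borderArray-left (suc i) = if-dec (toℕ (suc i) ≟ suc n)
    (λ i≡last → sym (frame-toℕ≡last v c (bar n w) (suc i) i≡last))
    (λ _ → refl)

  borderArray-right : ∀ i → borderArray n v w b c i (fromℕ (suc n)) ≡ frame w (bar n ∘ c) (bar n v) i
  borderArray-right zero    = frame-last v b w
  borderArray-right (suc i) = if-dec (toℕ (suc i) ≟ suc n)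
    (λ i≡last → trans (frame-last (bar n w) (bar n ∘ b) (bar n v))
                      (sym (frame-toℕ≡last w (bar n ∘ c) (bar n v) (suc i) i≡last)))
    (λ _ → if-last)

InN⇒≤Cn : ∀ {n x} → InN n x → x ≤ Cn n
InN⇒≤Cn {n} (inj₁ (_ , x≤2n+2)) =
  ≤-trans x≤2n+2 (≤-trans (m≤m+n _ (n * n + 2 * n + 3)) (≤-reflexive (split n)))
  where
    split : ∀ n → 2 * n + 2 + (n * n + 2 * n + 3) ≡ (n + 2) * ((n + 2) * 1) + 1
    split = solve-∀
InN⇒≤Cn {n} (inj₂ (_ , x≤[n+2]²)) = ≤-trans x≤[n+2]² (m≤m+n _ 1)

-- Doubled rather than s ≡ Sn n, because Sn truncates: this form also records that
-- (n + 2) C is even, which the complementary lines need.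
IsMagicSum : ℕ → ℕ → Set
IsMagicSum n s = s * 2 ≡ (n + 2) * Cn n

IsMagicSum⇒≡Sn : ∀ n {s} → IsMagicSum n s → s ≡ Sn n
IsMagicSum⇒≡Sn n {s} s*2≡ = trans (sym (m*n/n≡m s 2)) (cong (_/ 2) s*2≡)

IsMagicSum-complement : ∀ {n} a₁ a₂ z₁ z₂ (f : Fin n → ℕ) → (∀ k → f k ≤ Cn n) →
                        a₁ + a₂ ≡ Cn n → z₁ + z₂ ≡ Cn n →
                        IsMagicSum n (sumFin (frame a₁ f z₁)) →
                        IsMagicSum n (sumFin (frame z₂ (λ k → Cn n ∸ f k) a₂))
IsMagicSum-complement {n} a₁ a₂ z₁ z₂ f f≤C a₁+a₂≡C z₁+z₂≡C s₁*2≡ = trans (cong (_* 2) s₂≡s₁) s₁*2≡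
  where
    s₁ s₂ : ℕ
    s₁ = sumFin (frame a₁ f z₁)
    s₂ = sumFin (frame z₂ (λ k → Cn n ∸ f k) a₂)
    twice : ∀ s → s * 2 ≡ s + s
    twice = solve-∀
    s₂≡s₁ : s₂ ≡ s₁
    s₂≡s₁ = +-cancelʳ-≡ s₁ s₂ s₁ (begin
      s₂ + s₁        ≡⟨ sumFin-frame-complement (Cn n) a₁ a₂ z₁ z₂ f f≤C a₁+a₂≡C z₁+z₂≡C ⟩
      (n + 2) * Cn n ≡⟨ s₁*2≡ ⟨
      s₁ * 2         ≡⟨ twice s₁ ⟩
      s₁ + s₁        ∎)

IsMagicSum-pairs : ∀ {n s k h j} → s ≡ k * Cn n + h → k * 2 + j ≡ n + 2 → h * 2 ≡ j * Cn n →
                   IsMagicSum n s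
IsMagicSum-pairs {n} {s} {k} {h} {j} s≡ k*2+j≡ h*2≡ = begin
  s * 2                 ≡⟨ cong (_* 2) s≡ ⟩
  (k * C + h) * 2       ≡⟨ *-distribʳ-+ 2 (k * C) h ⟩
  k * C * 2 + h * 2     ≡⟨ cong₂ _+_ (xy∙z≈xz∙y k C 2) h*2≡ ⟩
  k * 2 * C + j * C     ≡⟨ *-distribʳ-+ C (k * 2) j ⟨
  (k * 2 + j) * C       ≡⟨ cong (_* C) k*2+j≡ ⟩
  (n + 2) * C           ∎
  where
    C = Cn n

borderArray-magic : ∀ n v w (b c : Fin n → ℕ) → v ≤ Cn n → w ≤ Cn n →
                    (∀ k → b k ≤ Cn n) → (∀ k → c k ≤ Cn n) →
                    IsMagicSum n (sumFin (frame v b w)) → IsMagicSum n (sumFin (frame v c (bar n w))) →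
                    MagicBorder n (borderArray n v w b c)
borderArray-magic n v w b c v≤C w≤C b≤C c≤C top left =
  trans (cong (_+_ v) (trans (borderArray-bottom last) (frame-last (bar n w) (bar n ∘ b) (bar n v))))
        (m+[n∸m]≡n v≤C) ,
  trans (cong₂ _+_ (frame-last v b w) (borderArray-bottom zero)) (m+[n∸m]≡n w≤C) ,
  (λ j → trans (cong₂ _+_ (frame-inner v b w j)
                          (trans (borderArray-bottom (suc (inject₁ j)))
                                 (frame-inner (bar n w) (bar n ∘ b) (bar n v) j)))
               (m+[n∸m]≡n (b≤C j))) ,
  (λ i → trans (cong₂ _+_ (trans (borderArray-left (suc (inject₁ i))) (frame-inner v c (bar n w) i))
                          (trans (borderArray-right (suc (inject₁ i)))
                                 (frame-inner w (bar n ∘ c) (bar n v) i)))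
               (m+[n∸m]≡n (c≤C i))) ,
  IsMagicSum⇒≡Sn n top ,
  trans (sumFin-cong borderArray-bottom) (IsMagicSum⇒≡Sn n bottom) ,
  trans (sumFin-cong borderArray-left) (IsMagicSum⇒≡Sn n left) ,
  trans (sumFin-cong borderArray-right) (IsMagicSum⇒≡Sn n right)
  where
    open BorderLines n v w b c
    last : Fin (suc (suc n))
    last = fromℕ (suc n)
    bottom : IsMagicSum n (sumFin (frame (bar n w) (bar n ∘ b) (bar n v)))
    bottom = IsMagicSum-complement v (bar n v) w (bar n w) b b≤C (m+[n∸m]≡n v≤C) (m+[n∸m]≡n w≤C) top
    right : IsMagicSum n (sumFin (frame w (bar n ∘ c) (bar n v)))
    right = IsMagicSum-complement v (bar n v) (bar n w) w c c≤C (m+[n∸m]≡n v≤C) (m∸n+n≡m w≤C) left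

length-flatten : ∀ ps → length (flatten ps) ≡ length ps * 2
length-flatten []       = refl
length-flatten (_ ∷ ps) = cong (_+_ 2) (length-flatten ps)

sum-dxy : ∀ n ps → sumℤ (map (uncurry (dxy n)) ps) ℤ.+ + (length ps * Cn n) ≡ + sum (flatten ps)
sum-dxy n []             = refl
sum-dxy n ((x , y) ∷ ps) = begin
  (+ (x + y) ℤ.- + C ℤ.+ D) ℤ.+ + (C + length ps * C)   ≡⟨ cong (ℤ._+_ (+ (x + y) ℤ.- + C ℤ.+ D)) (ℤₚ.pos-+ C _) ⟩
  (+ (x + y) ℤ.- + C ℤ.+ D) ℤ.+ (+ C ℤ.+ + (length ps * C)) ≡⟨ cancel (+ (x + y)) (+ C) D _ ⟩
  + (x + y) ℤ.+ (D ℤ.+ + (length ps * C))               ≡⟨ cong (ℤ._+_ (+ (x + y))) (sum-dxy n ps) ⟩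
  + (x + y + sum (flatten ps))                         ≡⟨ cong +_ (+-assoc x y _) ⟩
  + sum (flatten ((x , y) ∷ ps))                       ∎
  where
    C = Cn n
    D = sumℤ (map (uncurry (dxy n)) ps)
    cancel : ∀ p c d l → (p ℤ.- c ℤ.+ d) ℤ.+ (c ℤ.+ l) ≡ p ℤ.+ (d ℤ.+ l)
    cancel = ℤ-Solver.solve-∀

pairPartition-sum : ∀ {n xs extra target} → PairPartition n xs extra target →
                    ∃ λ k → k * 2 ≡ length xs × + sum xs ℤ.+ extra ≡ target ℤ.+ + (k * Cn n)
pairPartition-sum {n} {xs} {extra} {target} (ps , flat↭xs , pairs) =
  length ps , trans (sym (length-flatten ps)) (↭-length flat↭xs) , (begin
    + sum xs ℤ.+ extra                   ≡⟨ cong (λ s → + s ℤ.+ extra) (sum-↭ flat↭xs) ⟨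
    + sum (flatten ps) ℤ.+ extra         ≡⟨ cong (ℤ._+ extra) (sum-dxy n ps) ⟨
    (D ℤ.+ + (length ps * Cn n)) ℤ.+ extra ≡⟨ swap D _ extra ⟩
    (D ℤ.+ extra) ℤ.+ + (length ps * Cn n) ≡⟨ cong (ℤ._+ + (length ps * Cn n)) pairs ⟩
    target ℤ.+ + (length ps * Cn n)      ∎)
  where
    D = sumℤ (map (uncurry (dxy n)) ps)
    swap : ∀ d l e → (d ℤ.+ l) ℤ.+ e ≡ (d ℤ.+ e) ℤ.+ l
    swap = ℤ-Solver.solve-∀

x+[y-c]≡r⇒x+y≡r+c : ∀ x y c {r : ℤ} → x ℤ.+ (y ℤ.- c) ≡ r → x ℤ.+ y ≡ r ℤ.+ c
x+[y-c]≡r⇒x+y≡r+c x y c eq = trans (move x y c) (cong (ℤ._+ c) eq)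
  where
    move : ∀ x y c → x ℤ.+ y ≡ (x ℤ.+ (y ℤ.- c)) ℤ.+ c
    move = ℤ-Solver.solve-∀

x≡-d+r⇒x+d≡r : ∀ {x} d {r : ℤ} → x ≡ - d ℤ.+ r → x ℤ.+ d ≡ r
x≡-d+r⇒x+d≡r d {r} eq = trans (cong (ℤ._+ d) eq) (cancel d r)
  where
    cancel : ∀ d r → (- d ℤ.+ r) ℤ.+ d ≡ r
    cancel = ℤ-Solver.solve-∀

Cn/2*2≡Cn : ∀ {n k} → k * 2 ≡ n + 1 → Cn n / 2 * 2 ≡ Cn n
Cn/2*2≡Cn {n} {k} k*2≡n+1 = begin
  Cn n / 2 * 2  ≡⟨ cong (λ m → m / 2 * 2) C≡K*2 ⟩
  K * 2 / 2 * 2 ≡⟨ cong (_* 2) (m*n/n≡m K 2) ⟩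
  K * 2         ≡⟨ C≡K*2 ⟨
  Cn n          ∎
  where
    K : ℕ
    K = k * k * 2 + k * 2 + 1
    square : ∀ k → (k * 2 + 1) * ((k * 2 + 1) * 1) + 1 ≡ (k * k * 2 + k * 2 + 1) * 2
    square = solve-∀
    C≡K*2 : Cn n ≡ K * 2
    C≡K*2 = trans (cong (λ m → m ^ 2 + 1) (trans (sym (+-assoc n 1 1)) (cong (_+ 1) (sym k*2≡n+1))))
                  (square k)

topRow-even : ∀ {n} v w (b : Fin n → ℕ) → PairPartition n (v ∷ w ∷ tabulate b) (+ 0) (+ 0) →
              IsMagicSum n (sumFin (frame v b w))
topRow-even {n} v w b pp with pairPartition-sum {n} pp
... | k , k*2≡len , sum≡ = IsMagicSum-pairs {n} {k = k} {j = 0} top≡ k*2+0≡n+2 refl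
  where
    top≡ : sumFin (frame v b w) ≡ k * Cn n + 0
    top≡ = begin
      sumFin (frame v b w)          ≡⟨ sumFin-frame v b w ⟩
      v + (sumFin b + w)            ≡⟨ cong (_+_ v) (+-comm (sumFin b) w) ⟩
      v + (w + sumFin b)            ≡⟨ cong (λ s → v + (w + s)) (sum-tabulate b) ⟨
      sum (v ∷ w ∷ tabulate b)      ≡⟨ +-identityʳ _ ⟨
      sum (v ∷ w ∷ tabulate b) + 0  ≡⟨ ℤₚ.+-injective sum≡ ⟩
      k * Cn n                      ≡⟨ +-identityʳ _ ⟨
      k * Cn n + 0                  ∎
    k*2+0≡n+2 : k * 2 + 0 ≡ n + 2
    k*2+0≡n+2 = trans (+-identityʳ _)
                      (trans k*2≡len (trans (cong (_+_ 2) (length-tabulate b)) (+-comm 2 n)))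

leftColumn-even : ∀ {n} v w (c : Fin n → ℕ) → PairPartition n (tabulate c) (+ 0) (- dxy n v (bar n w)) →
                  IsMagicSum n (sumFin (frame v c (bar n w)))
leftColumn-even {n} v w c pp with pairPartition-sum {n} pp
... | k , k*2≡len , sum≡ =
  IsMagicSum-pairs {n} {k = k} {j = 2} left≡ (cong (_+ 2) (trans k*2≡len (length-tabulate c)))
                   (*-comm (Cn n) 2)
  where
    regroup : ∀ v s x → v + (s + x) ≡ (s + 0) + (v + x)
    regroup = solve-∀
    sum+corners≡ : + sum (tabulate c) ℤ.+ + 0 ℤ.+ + (v + bar n w) ≡ + (k * Cn n) ℤ.+ + Cn n
    sum+corners≡ = x+[y-c]≡r⇒x+y≡r+c (+ sum (tabulate c) ℤ.+ + 0) (+ (v + bar n w)) (+ Cn n)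
                 (x≡-d+r⇒x+d≡r (dxy n v (bar n w)) sum≡)
    left≡ : sumFin (frame v c (bar n w)) ≡ k * Cn n + Cn n
    left≡ = begin
      sumFin (frame v c (bar n w))            ≡⟨ sumFin-frame v c (bar n w) ⟩
      v + (sumFin c + bar n w)                ≡⟨ regroup v (sumFin c) (bar n w) ⟩
      (sumFin c + 0) + (v + bar n w)          ≡⟨ cong (λ s → (s + 0) + (v + bar n w)) (sum-tabulate c) ⟨
      (sum (tabulate c) + 0) + (v + bar n w)  ≡⟨ ℤₚ.+-injective sum+corners≡ ⟩
      k * Cn n + Cn n                         ∎

line-odd : ∀ {n} a (f : Fin n → ℕ) z →
           PairPartition n (tabulate f ++ (z ∷ [])) ((+ a) ℤ.- (+ (Cn n / 2))) (+ 0) →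
           IsMagicSum n (sumFin (frame a f z))
line-odd {n} a f z pp with pairPartition-sum {n} pp
... | k , k*2≡len , sum≡ =
  IsMagicSum-pairs {n} {k = k} {j = 1} line≡ (trans (cong (_+ 1) k*2≡n+1) (+-assoc n 1 1))
                   (trans (Cn/2*2≡Cn {n} {k} k*2≡n+1) (sym (*-identityˡ (Cn n))))
  where
    k*2≡n+1 : k * 2 ≡ n + 1
    k*2≡n+1 = trans k*2≡len (trans (length-++ (tabulate f)) (cong (_+ 1) (length-tabulate f)))
    sum-snoc : sum (tabulate f ++ (z ∷ [])) ≡ sumFin f + z
    sum-snoc = trans (sum-++ (tabulate f) (z ∷ [])) (cong₂ _+_ (sum-tabulate f) (+-identityʳ z))
    sum+a≡ : + sum (tabulate f ++ (z ∷ [])) ℤ.+ + a ≡ + (k * Cn n) ℤ.+ + (Cn n / 2)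
    sum+a≡ = x+[y-c]≡r⇒x+y≡r+c (+ sum (tabulate f ++ (z ∷ []))) (+ a) (+ (Cn n / 2)) sum≡
    line≡ : sumFin (frame a f z) ≡ k * Cn n + Cn n / 2
    line≡ = begin
      sumFin (frame a f z)               ≡⟨ sumFin-frame a f z ⟩
      a + (sumFin f + z)                 ≡⟨ +-comm a _ ⟩
      (sumFin f + z) + a                 ≡⟨ cong (_+ a) sum-snoc ⟨
      sum (tabulate f ++ (z ∷ [])) + a   ≡⟨ ℤₚ.+-injective sum+a≡ ⟩
      k * Cn n + Cn n / 2                ∎

n%2≡0⊎n%2≡1 : ∀ n → n % 2 ≡ 0 ⊎ n % 2 ≡ 1
n%2≡0⊎n%2≡1 n with n % 2 | m%n<n n 2
... | 0           | _ = inj₁ refl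
... | 1           | _ = inj₂ refl
... | suc (suc _) | s≤s (s≤s ())

theorem1 :
  (n : ℕ) → 1 ≤ n →
  (v w : ℕ) (b c : Fin n → ℕ) →
  All (InN n) (v ∷ w ∷ (tabulate b ++ tabulate c)) →
  AllPairs (λ x y → (x ≢ y) × (x + y ≢ Cn n)) (v ∷ w ∷ (tabulate b ++ tabulate c)) →
  (n % 2 ≡ 0 →
    PairPartition n (v ∷ w ∷ tabulate b) (+ 0) (+ 0)
    × PairPartition n (tabulate c) (+ 0) (- dxy n v (bar n w))) →
  (n % 2 ≡ 1 →
    PairPartition n (tabulate b ++ (w ∷ [])) ((+ v) ℤ.- (+ (Cn n / 2))) (+ 0)
    × PairPartition n (tabulate c ++ (bar n w ∷ [])) ((+ v) ℤ.- (+ (Cn n / 2))) (+ 0)) →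
  MagicBorder n (borderArray n v w b c)
theorem1 n _ v w b c (v∈N ∷ w∈N ∷ b,c∈N) _ even odd =
  borderArray-magic n v w b c (InN⇒≤Cn {n} v∈N) (InN⇒≤Cn {n} w∈N)
    (λ k → InN⇒≤Cn {n} (tabulate⁻ (proj₁ (++⁻ (tabulate b) b,c∈N)) k))
    (λ k → InN⇒≤Cn {n} (tabulate⁻ (proj₂ (++⁻ (tabulate b) b,c∈N)) k))
    (proj₁ magicLines) (proj₂ magicLines)
  where
    magicLines : IsMagicSum n (sumFin (frame v b w)) × IsMagicSum n (sumFin (frame v c (bar n w)))
    magicLines with n%2≡0⊎n%2≡1 n
    ... | inj₁ n-even = Product.map (topRow-even v w b) (leftColumn-even v w c) (even n-even)
    ... | inj₂ n-odd  = Product.map (line-odd v b w) (line-odd v c (bar n w)) (odd n-odd)
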